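{- Let $X$ be a graph, and let $G$ and $H$ be subgraphs of $X$ with $G\cup H=X$. If $G\cap H$ is convex in $X$, then $G$ and $H$ are also convex in $X$.
   Context: A graph means a finite undirected graph with no loops or multiple edges; it may be disconnected. For a graph $U$ and vertices $u,u'$ of $U$, $d_U(u,u')$ is the length of a shortest path from $u$ to $u'$ in $U$, or $\infty$ if there is none. Unions and intersections of subgraphs are taken on both vertex sets and edge sets. A subgraph $U$ of $X$ is convex in $X$ if $d_U(u,u')=d_X(u,u')$ for all vertices $u,u'$ of $U$. -}

module Defs where

open import Data.Nat using (ℕ; zero; suc; _<_)
open import Data.Fin using (Fin)
open import Data.Bool using (Bool; true; false; T; _∧_; _∨_)
open import Data.Product using (_×_; _,_)
open import Relation.Nullary using (¬_)
open import Relation.Binary.PropositionalEquality using (_≡_)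
open import Function.Bundles using (_⇔_)

record Graph : Set where
  field
    n     : ℕ
    adj   : Fin n → Fin n → Bool
    sym   : ∀ u v → adj u v ≡ adj v u
    irrefl : ∀ u → adj u u ≡ false

open Graph public

record Subgraph (X : Graph) : Set where
  field
    vert   : Fin (n X) → Bool
    edge   : Fin (n X) → Fin (n X) → Bool
    esym   : ∀ u v → edge u v ≡ edge v u
    e⊆adj  : ∀ u v → T (edge u v) → T (adj X u v)
    e⊆vert : ∀ u v → T (edge u v) → T (vert u) × T (vert v)

open Subgraph public

whole : (X : Graph) → Subgraph X
whole X = record
  { vert = λ _ → true
  ; edge = adj X
  ; esym = sym X
  ; e⊆adj = λ _ _ e → e
  ; e⊆vert = λ _ _ _ → _ , _
  }

_∩ˢ_ : {X : Graph} → Subgraph X → Subgraph X → Subgraph X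
_∩ˢ_ {X} G H = record
  { vert = λ v → vert G v ∧ vert H v
  ; edge = λ u v → edge G u v ∧ edge H u v
  ; esym = λ u v → eq u v
  ; e⊆adj = λ u v e → e⊆adj G u v (proj₁∧ e)
  ; e⊆vert = λ u v e → vv u v e
  }
  where
  open import Data.Bool.Properties using (T-∧)
  open Function.Bundles.Equivalence
  open import Relation.Binary.PropositionalEquality using (cong₂)
  open import Data.Product using (proj₁; proj₂)
  eq : ∀ u v → (edge G u v ∧ edge H u v) ≡ (edge G v u ∧ edge H v u)
  eq u v = cong₂ _∧_ (esym G u v) (esym H u v)
  proj₁∧ : ∀ {a b} → T (a ∧ b) → T a
  proj₁∧ e = proj₁ (to T-∧ e)
  vv : ∀ u v → T (edge G u v ∧ edge H u v) → T (vert G u ∧ vert H u) × T (vert G v ∧ vert H v)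
  vv u v e with to T-∧ e
  ... | eG , eH with e⊆vert G u v eG | e⊆vert H u v eH
  ... | gu , gv | hu , hv = from T-∧ (gu , hu) , from T-∧ (gv , hv)

_∪ˢ_ : {X : Graph} → Subgraph X → Subgraph X → Subgraph X
_∪ˢ_ {X} G H = record
  { vert = λ v → vert G v ∨ vert H v
  ; edge = λ u v → edge G u v ∨ edge H u v
  ; esym = λ u v → cong₂ _∨_ (esym G u v) (esym H u v)
  ; e⊆adj = λ u v e → ea u v e
  ; e⊆vert = λ u v e → ev u v e
  }
  where
  open import Data.Bool.Properties using (T-∨)
  open Function.Bundles.Equivalence
  open import Relation.Binary.PropositionalEquality using (cong₂)
  open import Data.Sum using (inj₁; inj₂)
  ea : ∀ u v → T (edge G u v ∨ edge H u v) → T (adj X u v)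
  ea u v e with to T-∨ e
  ... | inj₁ g = e⊆adj G u v g
  ... | inj₂ h = e⊆adj H u v h
  ev : ∀ u v → T (edge G u v ∨ edge H u v) → T (vert G u ∨ vert H u) × T (vert G v ∨ vert H v)
  ev u v e with to T-∨ e
  ... | inj₁ g with e⊆vert G u v g
  ...   | a , b = from T-∨ (inj₁ a) , from T-∨ (inj₁ b)
  ev u v e | inj₂ h with e⊆vert H u v h
  ...   | a , b = from T-∨ (inj₂ a) , from T-∨ (inj₂ b)

_≈ˢ_ : {X : Graph} → Subgraph X → Subgraph X → Set
G ≈ˢ H = (∀ v → vert G v ≡ vert H v) × (∀ u v → edge G u v ≡ edge H u v)

-- Walks of length k in U from u to u' (u a vertex of U).
-- A shortest walk is a path, so shortest walk length = shortest path length.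
data Walk {X : Graph} (U : Subgraph X) : Fin (n X) → Fin (n X) → ℕ → Set where
  [] : ∀ {u} → T (vert U u) → Walk U u u zero
  _∷_ : ∀ {u w u' k} → T (edge U u w) → Walk U w u' k → Walk U u u' (suc k)

data ℕ∞ : Set where
  fin : ℕ → ℕ∞
  ∞   : ℕ∞

Dist : {X : Graph} → Subgraph X → Fin (n X) → Fin (n X) → ℕ∞ → Set
Dist U u u' (fin k) = Walk U u u' k × (∀ j → j < k → ¬ Walk U u u' j)
Dist U u u' ∞       = ∀ j → ¬ Walk U u u' j

Convex : {X : Graph} → Subgraph X → Set
Convex {X} U = ∀ u u' → T (vert U u) → T (vert U u') →
  ∀ d → Dist U u u' d ⇔ Dist (whole X) u u' d

module Submission where

-- A subgraph U is convex as soon as it is *shortening*: every X-walk of length k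
-- between two vertices of U can be replaced by a U-walk of length at most k
-- between the same vertices (convex-if-shortening).
--
-- G is shortening: follow an X-walk between G-vertices edge by edge.  Edges of G
-- are kept.  An edge not in G lies in H, so the walk leaves G at a vertex a of
-- G ∩ H and runs through H until it reaches a vertex v of G, which then lies in
-- G ∩ H too.  The detour a ⇝ v is an X-walk between two vertices of the convex
-- subgraph K ⊆ G, so a shortest X-walk from a to v may be taken inside K, hence
-- inside G, and it is no longer than the detour (convex-shortcut).

open import Defs
open import Data.Product using (_×_; _,_; proj₁; proj₂; ∃)
open import Data.Nat using (ℕ; zero; suc; _+_; _≤_; _<_; z≤n; s≤s)
open import Data.Nat.Properties
  using (anyUpTo?; ≤-refl; ≤-trans; ≤-reflexive; <⇒≤; ≤-<-trans; m≤m+n; +-mono-≤;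
         +-assoc; m≤n⇒m<n∨m≡n)
open import Data.Nat.Induction using (<-rec)
open import Data.Fin using (Fin; _≟_)
open import Data.Fin.Properties using (any?)
open import Data.Bool using (T)
open import Data.Bool.Properties using (T-∧; T-∨)
open import Data.Sum using (_⊎_; inj₁; inj₂; swap)
open import Data.Unit using (tt)
open import Data.Empty using (⊥-elim)
open import Relation.Nullary using (¬_; Dec; yes; no)
open import Relation.Nullary.Decidable using (T?; _×-dec_)
open import Relation.Binary.PropositionalEquality using (refl; subst) renaming (sym to ≡-sym)
open import Function.Bundles using (mk⇔; Equivalence)

least : {P : ℕ → Set} → (∀ j → Dec (P j)) → ∀ m → P m →
  ∃ λ d → d ≤ m × P d × (∀ j → j < d → ¬ P j)
least {P} P? = <-rec (λ m → P m → ∃ λ d → d ≤ m × P d × (∀ j → j < d → ¬ P j)) step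
  where
  step : ∀ m → (∀ {k} → k < m → P k → ∃ λ d → d ≤ k × P d × (∀ j → j < d → ¬ P j)) →
    P m → ∃ λ d → d ≤ m × P d × (∀ j → j < d → ¬ P j)
  step m below pm with anyUpTo? P? m
  ... | yes (k , k<m , pk) =
    let (d , d≤k , pd , minimal) = below k<m pk in d , ≤-trans d≤k (<⇒≤ k<m) , pd , minimal
  ... | no none = m , ≤-refl , pm , λ j j<m pj → none (j , j<m , pj)

module _ {X : Graph} where

  record _⊆ˢ_ (U V : Subgraph X) : Set where
    field
      vert⊆ : ∀ u → T (vert U u) → T (vert V u)
      edge⊆ : ∀ u v → T (edge U u v) → T (edge V u v)
  open _⊆ˢ_

  WalkWithin : Subgraph X → Fin (n X) → Fin (n X) → ℕ → Set
  WalkWithin U u u' k = ∃ λ j → j ≤ k × Walk U u u' j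

  Shortening : Subgraph X → Set
  Shortening U = ∀ {u u' k} → T (vert U u) → T (vert U u') →
    Walk (whole X) u u' k → WalkWithin U u u' k

  walk? : (U : Subgraph X) → ∀ u u' k → Dec (Walk U u u' k)
  walk? U u u' zero with u ≟ u'
  ... | no u≢u' = no λ { ([] _) → u≢u' refl }
  ... | yes refl with T? (vert U u)
  ...   | yes uU = yes ([] uU)
  ...   | no u∉U = no λ { ([] uU) → u∉U uU }
  walk? U u u' (suc k) with any? (λ w → T? (edge U u w) ×-dec walk? U w u' k)
  ... | yes (w , e , p) = yes (e ∷ p)
  ... | no none = no λ { (_∷_ {w = w} e p) → none (w , e , p) }

  mapWalk : {U V : Subgraph X} → U ⊆ˢ V → ∀ {u u' k} → Walk U u u' k → Walk V u u' k
  mapWalk U⊆V ([] uU) = [] (vert⊆ U⊆V _ uU)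
  mapWalk U⊆V (_∷_ {u} {w} e p) = edge⊆ U⊆V u w e ∷ mapWalk U⊆V p

  ⊆-whole : (U : Subgraph X) → U ⊆ˢ whole X
  ⊆-whole U = record { vert⊆ = λ _ _ → tt ; edge⊆ = e⊆adj U }

  _++_ : {U : Subgraph X} → ∀ {u v w m k} → Walk U u v m → Walk U v w k → Walk U u w (m + k)
  [] _ ++ q = q
  (e ∷ p) ++ q = e ∷ (p ++ q)

  shortest : (U : Subgraph X) → ∀ {u u' m} → Walk U u u' m →
    ∃ λ d → d ≤ m × Dist U u u' (fin d)
  shortest U {u} {u'} {m} p =
    let (d , d≤m , q , minimal) = least (walk? U u u') m p in d , d≤m , q , minimal

  -- A shortening subgraph is convex: shortest X-walks between its vertices may be
  -- taken inside it, and no walk inside it is shorter than the X-distance.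
  convex-if-shortening : (U : Subgraph X) → Shortening U → Convex U
  convex-if-shortening U shorten u u' uU u'U (fin k) = mk⇔ toX fromX
    where
    toX : Dist U u u' (fin k) → Dist (whole X) u u' (fin k)
    toX (p , minU) = mapWalk (⊆-whole U) p , λ j j<k q →
      let (i , i≤j , r) = shorten uU u'U q in minU i (≤-<-trans i≤j j<k) r
    fromX : Dist (whole X) u u' (fin k) → Dist U u u' (fin k)
    fromX (q , minX) with shorten uU u'U q
    ... | i , i≤k , r with m≤n⇒m<n∨m≡n i≤k
    ...   | inj₁ i<k = ⊥-elim (minX i i<k (mapWalk (⊆-whole U) r))
    ...   | inj₂ refl = r , λ j j<k p → minX j j<k (mapWalk (⊆-whole U) p)
  convex-if-shortening U shorten u u' uU u'U ∞ = mk⇔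
    (λ noU j q → let (i , _ , r) = shorten uU u'U q in noU i r)
    (λ noX j p → noX j (mapWalk (⊆-whole U) p))

  -- An X-walk between vertices of a convex K ⊆ G can be replaced by a no longer
  -- G-walk: take a shortest X-walk, which by convexity is realised inside K.
  convex-shortcut : {K G : Subgraph X} → K ⊆ˢ G → Convex K →
    ∀ {a v m} → T (vert K a) → T (vert K v) → Walk (whole X) a v m → WalkWithin G a v m
  convex-shortcut K⊆G convK {a} {v} aK vK p with shortest (whole X) p
  ... | d , d≤m , distX with Equivalence.from (convK a v aK vK (fin d)) distX
  ...   | q , _ = d , d≤m , mapWalk K⊆G q

  within-cons : {U : Subgraph X} → ∀ {u w u' k} → T (edge U u w) →
    WalkWithin U w u' k → WalkWithin U u u' (suc k)
  within-cons e (j , j≤k , p) = suc j , s≤s j≤k , e ∷ p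

  within-++ : {U : Subgraph X} → ∀ {u v w m k} → WalkWithin U u v m →
    WalkWithin U v w k → WalkWithin U u w (m + k)
  within-++ (i , i≤m , p) (j , j≤k , q) = i + j , +-mono-≤ i≤m j≤k , p ++ q

  within-weaken : {U : Subgraph X} → ∀ {u u' k l} → k ≤ l →
    WalkWithin U u u' k → WalkWithin U u u' l
  within-weaken k≤l (j , j≤k , p) = j , ≤-trans j≤k k≤l , p

  module CoverShortening (G H K : Subgraph X)
    (covers : ∀ u v → T (adj X u v) → T (edge G u v) ⊎ T (edge H u v))
    (K⊆G : K ⊆ˢ G)
    (G∩H⊆K : ∀ u → T (vert G u) → T (vert H u) → T (vert K u))
    (convK : Convex K) where

    closeDetour : ∀ {a v m} → T (vert G a) → T (vert H a) → T (vert G v) → T (vert H v) →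
      Walk (whole X) a v m → WalkWithin G a v m
    closeDetour aG aH vG vH = convex-shortcut K⊆G convK (G∩H⊆K _ aG aH) (G∩H⊆K _ vG vH)

    -- shorten scans an X-walk while staying in G; shortenDetour scans the rest of
    -- the walk after a detour through H that started at a common vertex a and has
    -- so far reached v ∈ H.
    shorten : Shortening G
    shortenDetour : ∀ {a v u' m k} → T (vert G a) → T (vert H a) →
      Walk (whole X) a v m → T (vert H v) → Walk (whole X) v u' k → T (vert G u') →
      WalkWithin G a u' (m + k)

    shorten uG u'G ([] _) = 0 , z≤n , [] uG
    shorten uG u'G (_∷_ {u} {v} e w) with covers u v e
    ... | inj₁ eG = within-cons eG (shorten (proj₂ (e⊆vert G u v eG)) u'G w)
    ... | inj₂ eH =
      let (uH , vH) = e⊆vert H u v eH in shortenDetour uG uH (e ∷ [] tt) vH w u'G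

    shortenDetour {m = m} aG aH detour vH ([] _) u'G =
      within-weaken (m≤m+n m 0) (closeDetour aG aH u'G vH detour)
    shortenDetour aG aH detour vH (_∷_ {v} {v'} e w) u'G with covers v v' e
    ... | inj₁ eG =
      let (vG , v'G) = e⊆vert G v v' eG
      in within-++ (closeDetour aG aH vG vH detour) (within-cons eG (shorten v'G u'G w))
    shortenDetour {m = m} {k = suc k} aG aH detour vH (e ∷ w) u'G | inj₂ eH =
      within-weaken (≤-reflexive (+-assoc m 1 k))
        (shortenDetour aG aH (detour ++ (e ∷ [] tt)) (proj₂ (e⊆vert H _ _ eH)) w u'G)

  ∩-⊆ˡ : (G H : Subgraph X) → (G ∩ˢ H) ⊆ˢ G
  ∩-⊆ˡ G H = record
    { vert⊆ = λ u x → proj₁ (Equivalence.to T-∧ x)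
    ; edge⊆ = λ u v e → proj₁ (Equivalence.to T-∧ e) }

  ∩-⊆ʳ : (G H : Subgraph X) → (G ∩ˢ H) ⊆ˢ H
  ∩-⊆ʳ G H = record
    { vert⊆ = λ u x → proj₂ (Equivalence.to T-∧ x)
    ; edge⊆ = λ u v e → proj₂ (Equivalence.to T-∧ e) }

  ∩-common : (G H : Subgraph X) → ∀ u → T (vert G u) → T (vert H u) → T (vert (G ∩ˢ H) u)
  ∩-common G H u uG uH = Equivalence.from T-∧ (uG , uH)

  ∪-covers : (G H : Subgraph X) → (G ∪ˢ H) ≈ˢ whole X →
    ∀ u v → T (adj X u v) → T (edge G u v) ⊎ T (edge H u v)
  ∪-covers G H (_ , sameEdges) u v e = Equivalence.to T-∨ (subst T (≡-sym (sameEdges u v)) e)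

lemma4p3 : (X : Graph) (G H : Subgraph X) →
    (G ∪ˢ H) ≈ˢ whole X →
    Convex (G ∩ˢ H) →
    Convex G × Convex H
lemma4p3 X G H G∪H≈X convG∩H = convex-if-shortening G shortenG , convex-if-shortening H shortenH
  where
  covers : ∀ u v → T (adj X u v) → T (edge G u v) ⊎ T (edge H u v)
  covers = ∪-covers G H G∪H≈X
  shortenG : Shortening G
  shortenG = CoverShortening.shorten G H (G ∩ˢ H) covers (∩-⊆ˡ G H) (∩-common G H) convG∩H
  shortenH : Shortening H
  shortenH = CoverShortening.shorten H G (G ∩ˢ H) (λ u v e → swap (covers u v e)) (∩-⊆ʳ G H)
    (λ u uH uG → ∩-common G H u uG uH) convG∩H
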